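{- Let $\nu_1,\dots,\nu_\ell$ be positive integers whose product $\nu_1\cdots\nu_\ell$ is a perfect square. Then there exists an upper triangular array of $\binom{\ell+1}{2}$ positive integers $(b_{rs})_{1\le r\le s\le \ell}$ such that for each $1\le r\le\ell$ we have $b_{rr}^2=sq(\nu_r)$ and $$\nu_r=(b_{1r}b_{2r}\cdots b_{rr})(b_{rr}b_{r,r+1}\cdots b_{r\ell}),$$ i.e. $\nu_r$ is the product of the entries of column $r$ times the product of the entries of row $r$.
   Context: For a positive integer $\nu$, $sq(\nu)$ denotes the largest perfect square dividing $\nu$ (so $\nu/sq(\nu)$ is squarefree). -}

module Defs where

open import Data.Nat using (ℕ; zero; suc; _*_; _≤_)
open import Data.Nat.Divisibility using (_∣_)
open import Data.Fin using (Fin; zero; suc; toℕ)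
open import Data.Product using (Σ; _×_)
open import Relation.Binary.PropositionalEquality using (_≡_)

∏ : (n : ℕ) → (Fin n → ℕ) → ℕ
∏ zero    f = 1
∏ (suc n) f = f zero * ∏ n (λ i → f (suc i))

if≤ : ℕ → ℕ → ℕ → ℕ
if≤ zero    _       x = x
if≤ (suc m) zero    x = 1
if≤ (suc m) (suc n) x = if≤ m n x

colProd : (ℓ : ℕ) → (Fin ℓ → Fin ℓ → ℕ) → Fin ℓ → ℕ
colProd ℓ b r = ∏ ℓ (λ i → if≤ (toℕ i) (toℕ r) (b i r))

rowProd : (ℓ : ℕ) → (Fin ℓ → Fin ℓ → ℕ) → Fin ℓ → ℕ
rowProd ℓ b r = ∏ ℓ (λ s → if≤ (toℕ r) (toℕ s) (b r s))

IsSquare : ℕ → Set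
IsSquare n = Σ ℕ (λ k → n ≡ k * k)

IsSq : ℕ → ℕ → Set
IsSq n m = IsSquare m × m ∣ n × ((d : ℕ) → (d * d) ∣ n → d * d ≤ m)

-- Write νᵣ = qᵣ eᵣ² with eᵣ² = sq(νᵣ) and qᵣ squarefree. As ∏ ν = (∏ e)² ∏ q is a square, so is
-- ∏ q. Squarefree numbers with square product factor through a strictly upper triangular array,
-- qᵣ = (∏_{i<r} c_{ir}) (∏_{s>r} c_{rs}): the squarefree q₁ divides the square q₁ ∏_{s>1} q_s, hence
-- divides ∏_{s>1} q_s and can be spread over the first row, after which the cofactors are again
-- squarefree with square product. Putting eᵣ on the diagonal gives b.
module Submission where

open import Defs
open import Data.Nat using (ℕ; zero; suc; _*_; _<_; _≤_; z≤n; s≤s; z<s; NonZero; >-nonZero; _/_)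
open import Data.Nat.Properties hiding (_≟_)
open import Data.Nat.Divisibility
open import Data.Nat.DivMod using (m/n*n≡m)
open import Data.Nat.GCD using (gcd; gcd[m,n]∣m; gcd[m,n]∣n; gcd[m,n]≢0)
open import Data.Nat.Coprimality using (Coprime; coprime-/gcd; coprime-divisor)
open import Data.Nat.Tactic.RingSolver using (solve-∀)
open import Data.Fin using (Fin; toℕ; zero; suc; _≟_)
open import Data.Product using (Σ; _×_; _,_; proj₁; proj₂)
open import Data.Sum using (inj₁; inj₂)
open import Data.Empty using (⊥-elim)
open import Relation.Nullary using (yes; no)
open import Relation.Binary.PropositionalEquality
open ≡-Reasoning

m*n>0⇒m>0 : ∀ m n → 0 < m * n → 0 < m
m*n>0⇒m>0 (suc m) n _ = z<s

m>0∧n>0⇒m*n>0 : ∀ {m n} → 0 < m → 0 < n → 0 < m * n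
m>0∧n>0⇒m*n>0 {suc m} {suc n} _ _ = z<s

∏-cong : ∀ n {f g : Fin n → ℕ} → (∀ i → f i ≡ g i) → ∏ n f ≡ ∏ n g
∏-cong zero    f≡g = refl
∏-cong (suc n) f≡g = cong₂ _*_ (f≡g zero) (∏-cong n (λ i → f≡g (suc i)))

∏-distrib-* : ∀ n (f g : Fin n → ℕ) → ∏ n (λ i → f i * g i) ≡ ∏ n f * ∏ n g
∏-distrib-* zero    f g = refl
∏-distrib-* (suc n) f g = begin
  f zero * g zero * ∏ n (λ i → f (suc i) * g (suc i))
    ≡⟨ cong (f zero * g zero *_) (∏-distrib-* n (λ i → f (suc i)) (λ i → g (suc i))) ⟩
  f zero * g zero * (∏ n (λ i → f (suc i)) * ∏ n (λ i → g (suc i)))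
    ≡⟨ interchange (f zero) (g zero) _ _ ⟩
  f zero * ∏ n (λ i → f (suc i)) * (g zero * ∏ n (λ i → g (suc i))) ∎
  where
  interchange : ∀ a b c d → a * b * (c * d) ≡ a * c * (b * d)
  interchange = solve-∀

∏-*-square : ∀ n (q e : Fin n → ℕ) → ∏ n (λ i → q i * (e i * e i)) ≡ ∏ n e * ∏ n e * ∏ n q
∏-*-square n q e = begin
  ∏ n (λ i → q i * (e i * e i)) ≡⟨ ∏-distrib-* n q (λ i → e i * e i) ⟩
  ∏ n q * ∏ n (λ i → e i * e i) ≡⟨ cong (∏ n q *_) (∏-distrib-* n e e) ⟩
  ∏ n q * (∏ n e * ∏ n e)       ≡⟨ *-comm (∏ n q) _ ⟩
  ∏ n e * ∏ n e * ∏ n q         ∎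

∏-1 : ∀ n → ∏ n (λ _ → 1) ≡ 1
∏-1 zero    = refl
∏-1 (suc n) = trans (*-identityˡ _) (∏-1 n)

∏-positive : ∀ n (f : Fin n → ℕ) → (∀ i → 0 < f i) → 0 < ∏ n f
∏-positive zero    f f>0 = z<s
∏-positive (suc n) f f>0 = m>0∧n>0⇒m*n>0 (f>0 zero) (∏-positive n (λ i → f (suc i)) (λ i → f>0 (suc i)))

gcd-cofactors : ∀ m k → 0 < m → Σ ℕ λ g → Σ ℕ λ m′ → Σ ℕ λ k′ →
  0 < g × m ≡ m′ * g × k ≡ k′ * g × Coprime m′ k′
gcd-cofactors m k m>0 = g , m / g , k / g , n≢0⇒n>0 g≢0 ,
  sym (m/n*n≡m (gcd[m,n]∣m m k)) , sym (m/n*n≡m (gcd[m,n]∣n m k)) , coprime-/gcd m k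
  where
  g = gcd m k
  g≢0 = gcd[m,n]≢0 m k (inj₁ (n>0⇒n≢0 m>0))
  instance
    g-nonZero : NonZero g
    g-nonZero = >-nonZero (n≢0⇒n>0 g≢0)

m*m∣n*n⇒m∣n : ∀ m n → m * m ∣ n * n → m ∣ n
m*m∣n*n⇒m∣n zero n 0∣n*n with m*n≡0⇒m≡0∨n≡0 n (0∣⇒≡0 0∣n*n)
... | inj₁ refl = ∣-refl
... | inj₂ refl = ∣-refl
m*m∣n*n⇒m∣n m@(suc _) n = positive m n z<s
  where
  square-interchange : ∀ a g → a * g * (a * g) ≡ g * g * (a * a)
  square-interchange = solve-∀

  positive : ∀ m n → 0 < m → m * m ∣ n * n → m ∣ n
  positive m n m>0 mm∣nn with gcd-cofactors m n m>0
  ... | g , m′ , n′ , g>0 , refl , refl , coprime =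
    subst (λ x → x * g ∣ n′ * g) (sym m′≡1) (*-monoˡ-∣ g (1∣ n′))
    where
    instance
      g*g-nonZero : NonZero (g * g)
      g*g-nonZero = >-nonZero (m>0∧n>0⇒m*n>0 g>0 g>0)
    m′m′∣n′n′ : m′ * m′ ∣ n′ * n′
    m′m′∣n′n′ = *-cancelˡ-∣ (g * g)
      (subst₂ _∣_ (square-interchange m′ g) (square-interchange n′ g) mm∣nn)
    m′≡1 : m′ ≡ 1
    m′≡1 = coprime (∣-refl , coprime-divisor coprime (m*n∣⇒m∣ m′ m′ m′m′∣n′n′))

square-cancelˡ : ∀ m n → 0 < m → IsSquare (m * m * n) → IsSquare n
square-cancelˡ m n m>0 (k , mmn≡kk)
  with m*m∣n*n⇒m∣n m k (subst (m * m ∣_) mmn≡kk (m∣m*n n))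
... | divides-refl t = t , *-cancelˡ-≡ n (t * t) (m * m) (trans mmn≡kk (square-interchange t m))
  where
  instance
    m*m-nonZero : NonZero (m * m)
    m*m-nonZero = >-nonZero (m>0∧n>0⇒m*n>0 m>0 m>0)
  square-interchange : ∀ t m → t * m * (t * m) ≡ m * m * (t * t)
  square-interchange = solve-∀

SquareFree : ℕ → Set
SquareFree m = ∀ d → d * d ∣ m → d ≤ 1

squareFree⇒positive : ∀ {m} → SquareFree m → 0 < m
squareFree⇒positive {zero} sf with sf 2 ((2 * 2) ∣0)
... | s≤s ()
squareFree⇒positive {suc m} sf = z<s

squareFree-∣ : ∀ {d m} → d ∣ m → SquareFree m → SquareFree d
squareFree-∣ d∣m sf e ee∣d = sf e (∣-trans ee∣d d∣m)

squareFree∧∣n*n⇒∣n : ∀ {m n} → SquareFree m → m ∣ n * n → m ∣ n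
squareFree∧∣n*n⇒∣n {m} {n} sf m∣nn with gcd-cofactors m n (squareFree⇒positive sf)
... | g , m′ , n′ , g>0 , refl , refl , coprime =
  subst (λ x → x * g ∣ n′ * g) (sym m′≡1) (*-monoˡ-∣ g (1∣ n′))
  where
  instance
    g-nonZero : NonZero g
    g-nonZero = >-nonZero g>0
  rearrange : ∀ n′ g → n′ * g * (n′ * g) ≡ g * (n′ * (n′ * g))
  rearrange = solve-∀
  -- m′ is coprime to n′, so m′ ∣ n′ n′ g forces m′ ∣ g, and then m′² ∣ m.
  m′∣g : m′ ∣ g
  m′∣g = coprime-divisor coprime (coprime-divisor coprime
    (*-cancelˡ-∣ g (subst₂ _∣_ (*-comm m′ g) (rearrange n′ g) m∣nn)))
  m′≡1 : m′ ≡ 1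
  m′≡1 = ≤-antisym (sf m′ (*-monoʳ-∣ m′ m′∣g))
    (m*n>0⇒m>0 m′ g (squareFree⇒positive sf))

∣∏-split : ∀ n x (m : Fin n → ℕ) → 0 < x → x ∣ ∏ n m →
  Σ (Fin n → ℕ) λ d → Σ (Fin n → ℕ) λ m′ → ∏ n d ≡ x × (∀ i → m i ≡ d i * m′ i)
∣∏-split zero    x m x>0 x∣1 = (λ ()) , (λ ()) , sym (∣1⇒≡1 x∣1) , λ ()
∣∏-split (suc n) x m x>0 x∣∏m with gcd-cofactors x (m zero) x>0
... | g , x′ , m₀′ , g>0 , refl , m₀≡m₀′g , coprime = d , m′ , ∏d≡x′g , m≡dm′
  where
  instance
    g-nonZero : NonZero g
    g-nonZero = >-nonZero g>0
  P = ∏ n (λ i → m (suc i))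
  x′∣m₀′P : x′ ∣ m₀′ * P
  x′∣m₀′P = *-cancelˡ-∣ g (subst₂ _∣_ (*-comm x′ g)
    (trans (cong (_* P) (trans m₀≡m₀′g (*-comm m₀′ g))) (*-assoc g m₀′ P)) x∣∏m)
  rest = ∣∏-split n x′ (λ i → m (suc i)) (m*n>0⇒m>0 x′ g x>0) (coprime-divisor coprime x′∣m₀′P)
  d : Fin (suc n) → ℕ
  d zero    = g
  d (suc i) = proj₁ rest i
  m′ : Fin (suc n) → ℕ
  m′ zero    = m₀′
  m′ (suc i) = proj₁ (proj₂ rest) i
  ∏d≡x′g : ∏ (suc n) d ≡ x′ * g
  ∏d≡x′g = trans (cong (g *_) (proj₁ (proj₂ (proj₂ rest)))) (*-comm g x′)
  m≡dm′ : ∀ i → m i ≡ d i * m′ i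
  m≡dm′ zero    = trans m₀≡m₀′g (*-comm m₀′ g)
  m≡dm′ (suc i) = proj₂ (proj₂ (proj₂ rest)) i

strictColProd : (ℓ : ℕ) → (Fin ℓ → Fin ℓ → ℕ) → Fin ℓ → ℕ
strictColProd ℓ b r = ∏ ℓ (λ i → if≤ (suc (toℕ i)) (toℕ r) (b i r))

strictRowProd : (ℓ : ℕ) → (Fin ℓ → Fin ℓ → ℕ) → Fin ℓ → ℕ
strictRowProd ℓ b r = ∏ ℓ (λ s → if≤ (suc (toℕ r)) (toℕ s) (b r s))

record Peeling ℓ (m : Fin (suc ℓ) → ℕ) : Set where
  field
    factor              : Fin ℓ → ℕ
    cofactor            : Fin ℓ → ℕ
    ∏factor≡head        : ∏ ℓ factor ≡ m zero
    tail≡factor*cofactor : ∀ i → m (suc i) ≡ factor i * cofactor i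
    cofactor-squareFree : ∀ i → SquareFree (cofactor i)
    ∏cofactor-square    : IsSquare (∏ ℓ cofactor)

squareFree-peel : ∀ ℓ (m : Fin (suc ℓ) → ℕ) → (∀ r → SquareFree (m r)) → IsSquare (∏ (suc ℓ) m) →
  Peeling ℓ m
squareFree-peel ℓ m sf (k , ∏m≡kk) = record
  { factor = d ; cofactor = m′ ; ∏factor≡head = ∏d≡x ; tail≡factor*cofactor = m≡dm′
  ; cofactor-squareFree = m′-squareFree ; ∏cofactor-square = ∏m′-square }
  where
  x = m zero
  P = ∏ ℓ (λ i → m (suc i))
  x>0 : 0 < x
  x>0 = squareFree⇒positive (sf zero)
  instance
    x-nonZero : NonZero x
    x-nonZero = >-nonZero x>0
  x∣k : x ∣ k
  x∣k = squareFree∧∣n*n⇒∣n (sf zero) (subst (x ∣_) ∏m≡kk (m∣m*n P))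
  x∣P : x ∣ P
  x∣P = *-cancelˡ-∣ x (subst (x * x ∣_) (sym ∏m≡kk) (*-pres-∣ x∣k x∣k))
  split = ∣∏-split ℓ x (λ i → m (suc i)) x>0 x∣P
  d  = proj₁ split
  m′ = proj₁ (proj₂ split)
  ∏d≡x : ∏ ℓ d ≡ x
  ∏d≡x = proj₁ (proj₂ (proj₂ split))
  m≡dm′ : ∀ i → m (suc i) ≡ d i * m′ i
  m≡dm′ = proj₂ (proj₂ (proj₂ split))
  P≡x∏m′ : P ≡ x * ∏ ℓ m′
  P≡x∏m′ = begin
    P                      ≡⟨ ∏-cong ℓ m≡dm′ ⟩
    ∏ ℓ (λ i → d i * m′ i) ≡⟨ ∏-distrib-* ℓ d m′ ⟩
    ∏ ℓ d * ∏ ℓ m′         ≡⟨ cong (_* ∏ ℓ m′) ∏d≡x ⟩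
    x * ∏ ℓ m′             ∎
  ∏m′-square : IsSquare (∏ ℓ m′)
  ∏m′-square = square-cancelˡ x (∏ ℓ m′) x>0
    (k , trans (*-assoc x x (∏ ℓ m′)) (trans (cong (x *_) (sym P≡x∏m′)) ∏m≡kk))
  m′-squareFree : ∀ i → SquareFree (m′ i)
  m′-squareFree i = squareFree-∣ (subst (m′ i ∣_) (sym (m≡dm′ i)) (n∣m*n (d i))) (sf (suc i))

squareFree⇒strictTriangularFactorisation : ∀ ℓ (m : Fin ℓ → ℕ) →
  (∀ r → SquareFree (m r)) → IsSquare (∏ ℓ m) →
  Σ (Fin ℓ → Fin ℓ → ℕ) λ c → (∀ r s → 0 < c r s) ×
    (∀ r → m r ≡ strictColProd ℓ c r * strictRowProd ℓ c r)
squareFree⇒strictTriangularFactorisation zero    m sf square = (λ ()) , (λ ()) , λ ()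
squareFree⇒strictTriangularFactorisation (suc ℓ) m sf square = c , c>0 , m≡col*row
  where
  open Peeling (squareFree-peel ℓ m sf square)
  rest = squareFree⇒strictTriangularFactorisation ℓ cofactor cofactor-squareFree ∏cofactor-square
  c′ = proj₁ rest
  c : Fin (suc ℓ) → Fin (suc ℓ) → ℕ
  c zero    zero    = 1
  c zero    (suc s) = factor s
  c (suc r) zero    = 1
  c (suc r) (suc s) = c′ r s
  c>0 : ∀ r s → 0 < c r s
  c>0 zero    zero    = z<s
  c>0 zero    (suc s) = m*n>0⇒m>0 (factor s) (cofactor s)
    (subst (0 <_) (tail≡factor*cofactor s) (squareFree⇒positive (sf (suc s))))
  c>0 (suc r) zero    = z<s
  c>0 (suc r) (suc s) = proj₁ (proj₂ rest) r s
  m≡col*row : ∀ r → m r ≡ strictColProd (suc ℓ) c r * strictRowProd (suc ℓ) c r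
  m≡col*row zero = begin
    m zero                                ≡⟨ sym ∏factor≡head ⟩
    ∏ ℓ factor                            ≡⟨ sym (trans (*-identityˡ _) (*-identityˡ _)) ⟩
    1 * (1 * ∏ ℓ factor)                  ≡⟨ cong (λ z → 1 * z * (1 * ∏ ℓ factor)) (sym (∏-1 ℓ)) ⟩
    1 * ∏ ℓ (λ _ → 1) * (1 * ∏ ℓ factor)  ∎
  m≡col*row (suc r) = begin
    m (suc r)                                                     ≡⟨ tail≡factor*cofactor r ⟩
    factor r * cofactor r                                         ≡⟨ cong (factor r *_) (proj₂ (proj₂ rest) r) ⟩
    factor r * (strictColProd ℓ c′ r * strictRowProd ℓ c′ r)      ≡⟨ rearrange (factor r) _ _ ⟩
    factor r * strictColProd ℓ c′ r * (1 * strictRowProd ℓ c′ r)  ∎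
    where
    rearrange : ∀ a b c → a * (b * c) ≡ a * b * (1 * c)
    rearrange = solve-∀

largestSquareDivisor-bounded : ∀ n B → Σ ℕ λ e → 0 < e × e * e ∣ n × (∀ d → d ≤ B → d * d ∣ n → d ≤ e)
largestSquareDivisor-bounded n zero = 1 , z<s , 1∣ n , λ { zero _ _ → z≤n }
largestSquareDivisor-bounded n (suc B) with largestSquareDivisor-bounded n B | suc B * suc B ∣? n
... | _ | yes B+1²∣n = suc B , z<s , B+1²∣n , λ d d≤B+1 _ → d≤B+1
... | e , e>0 , ee∣n , maximal | no B+1²∤n = e , e>0 , ee∣n , maximal′
  where
  maximal′ : ∀ d → d ≤ suc B → d * d ∣ n → d ≤ e
  maximal′ d d≤B+1 dd∣n with m≤n⇒m<n∨m≡n d≤B+1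
  ... | inj₁ d<B+1 = maximal d (≤-pred d<B+1) dd∣n
  ... | inj₂ refl  = ⊥-elim (B+1²∤n dd∣n)

largestSquareDivisor : ∀ n → 0 < n → Σ ℕ λ e → 0 < e × e * e ∣ n × (∀ d → d * d ∣ n → d ≤ e)
largestSquareDivisor n n>0 with largestSquareDivisor-bounded n n
... | e , e>0 , ee∣n , maximal = e , e>0 , ee∣n , λ d dd∣n → maximal d (d≤n d dd∣n) dd∣n
  where
  instance
    n-nonZero : NonZero n
    n-nonZero = >-nonZero n>0
  d≤n : ∀ d → d * d ∣ n → d ≤ n
  d≤n zero    _    = z≤n
  d≤n (suc d) dd∣n = ≤-trans (m≤m*n (suc d) (suc d)) (∣⇒≤ dd∣n)

record SquareFactorisation (n : ℕ) : Set where
  field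
    root                : ℕ
    kernel              : ℕ
    root>0              : 0 < root
    isSq                : IsSq n (root * root)
    kernel-squareFree   : SquareFree kernel
    n≡kernel*root²      : n ≡ kernel * (root * root)

squareFactorisation : ∀ n → 0 < n → SquareFactorisation n
squareFactorisation n n>0 with largestSquareDivisor n n>0
... | e , e>0 , divides-refl q , maximal = record
  { root              = e
  ; kernel            = q
  ; root>0            = e>0
  ; isSq              = (e , refl) , divides-refl q , λ d dd∣n → *-mono-≤ (maximal d dd∣n) (maximal d dd∣n)
  ; kernel-squareFree = q-squareFree
  ; n≡kernel*root²    = refl
  }
  where
  instance
    e-nonZero : NonZero e
    e-nonZero = >-nonZero e>0
  rearrange : ∀ e d → e * e * (d * d) ≡ e * d * (e * d)
  rearrange = solve-∀
  q-squareFree : SquareFree q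
  q-squareFree d dd∣q = *-cancelʳ-≤ d 1 e (subst₂ _≤_ (*-comm e d) (sym (*-identityˡ e))
    (maximal (e * d) (subst₂ _∣_ (rearrange e d) (*-comm (e * e) q) (*-monoʳ-∣ (e * e) dd∣q))))

if≤-cong : ∀ a b {x y} → (a ≤ b → x ≡ y) → if≤ a b x ≡ if≤ a b y
if≤-cong zero    b       x≡y = x≡y z≤n
if≤-cong (suc a) zero    x≡y = refl
if≤-cong (suc a) (suc b) x≡y = if≤-cong a b (λ a≤b → x≡y (s≤s a≤b))

∏-if≤ˡ-split : ∀ ℓ (r : Fin ℓ) (g : Fin ℓ → ℕ) →
  ∏ ℓ (λ i → if≤ (toℕ i) (toℕ r) (g i)) ≡ ∏ ℓ (λ i → if≤ (suc (toℕ i)) (toℕ r) (g i)) * g r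
∏-if≤ˡ-split (suc ℓ) zero g = begin
  g zero * ∏ ℓ (λ _ → 1)     ≡⟨ cong (g zero *_) (∏-1 ℓ) ⟩
  g zero * 1                 ≡⟨ *-comm (g zero) 1 ⟩
  1 * g zero                 ≡⟨ cong (λ z → 1 * z * g zero) (sym (∏-1 ℓ)) ⟩
  1 * ∏ ℓ (λ _ → 1) * g zero ∎
∏-if≤ˡ-split (suc ℓ) (suc r) g =
  trans (cong (g zero *_) (∏-if≤ˡ-split ℓ r (λ i → g (suc i)))) (sym (*-assoc (g zero) _ _))

∏-if≤ʳ-split : ∀ ℓ (r : Fin ℓ) (g : Fin ℓ → ℕ) →
  ∏ ℓ (λ s → if≤ (toℕ r) (toℕ s) (g s)) ≡ g r * ∏ ℓ (λ s → if≤ (suc (toℕ r)) (toℕ s) (g s))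
∏-if≤ʳ-split (suc ℓ) zero    g = cong (g zero *_) (sym (*-identityˡ _))
∏-if≤ʳ-split (suc ℓ) (suc r) g = trans (*-identityˡ _)
  (trans (∏-if≤ʳ-split ℓ r (λ s → g (suc s))) (cong (g (suc r) *_) (sym (*-identityˡ _))))

colProd*rowProd≡strict*diagonal² : ∀ ℓ b (r : Fin ℓ) →
  colProd ℓ b r * rowProd ℓ b r ≡ strictColProd ℓ b r * strictRowProd ℓ b r * (b r r * b r r)
colProd*rowProd≡strict*diagonal² ℓ b r = begin
  colProd ℓ b r * rowProd ℓ b r
    ≡⟨ cong₂ _*_ (∏-if≤ˡ-split ℓ r (λ i → b i r)) (∏-if≤ʳ-split ℓ r (b r)) ⟩
  strictColProd ℓ b r * b r r * (b r r * strictRowProd ℓ b r)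
    ≡⟨ rearrange (strictColProd ℓ b r) (strictRowProd ℓ b r) (b r r) ⟩
  strictColProd ℓ b r * strictRowProd ℓ b r * (b r r * b r r) ∎
  where
  rearrange : ∀ C R x → C * x * (x * R) ≡ C * R * (x * x)
  rearrange = solve-∀

withDiagonal : ∀ {ℓ} → (Fin ℓ → ℕ) → (Fin ℓ → Fin ℓ → ℕ) → Fin ℓ → Fin ℓ → ℕ
withDiagonal e c r s with r ≟ s
... | yes _ = e r
... | no  _ = c r s

withDiagonal-diagonal : ∀ {ℓ} e c (r : Fin ℓ) → withDiagonal e c r r ≡ e r
withDiagonal-diagonal e c r with r ≟ r
... | yes _   = refl
... | no  r≢r = ⊥-elim (r≢r refl)

withDiagonal-offDiagonal : ∀ {ℓ} e c {r s : Fin ℓ} → r ≢ s → withDiagonal e c r s ≡ c r s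
withDiagonal-offDiagonal e c {r} {s} r≢s with r ≟ s
... | yes r≡s = ⊥-elim (r≢s r≡s)
... | no  _   = refl

withDiagonal-positive : ∀ {ℓ} {e c} → (∀ r → 0 < e r) → (∀ r s → 0 < c r s) →
  ∀ (r s : Fin ℓ) → 0 < withDiagonal e c r s
withDiagonal-positive {e = e} {c} e>0 c>0 r s with r ≟ s
... | yes _ = e>0 r
... | no  _ = c>0 r s

strictColProd-withDiagonal : ∀ ℓ e c (r : Fin ℓ) →
  strictColProd ℓ (withDiagonal e c) r ≡ strictColProd ℓ c r
strictColProd-withDiagonal ℓ e c r = ∏-cong ℓ λ i → if≤-cong (suc (toℕ i)) (toℕ r)
  λ i<r → withDiagonal-offDiagonal e c (λ i≡r → <-irrefl (cong toℕ i≡r) i<r)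

strictRowProd-withDiagonal : ∀ ℓ e c (r : Fin ℓ) →
  strictRowProd ℓ (withDiagonal e c) r ≡ strictRowProd ℓ c r
strictRowProd-withDiagonal ℓ e c r = ∏-cong ℓ λ s → if≤-cong (suc (toℕ r)) (toℕ s)
  λ r<s → withDiagonal-offDiagonal e c (λ r≡s → <-irrefl (cong toℕ r≡s) r<s)

colProd*rowProd-withDiagonal : ∀ ℓ e c (r : Fin ℓ) →
  colProd ℓ (withDiagonal e c) r * rowProd ℓ (withDiagonal e c) r ≡
  strictColProd ℓ c r * strictRowProd ℓ c r * (e r * e r)
colProd*rowProd-withDiagonal ℓ e c r = begin
  colProd ℓ b r * rowProd ℓ b r
    ≡⟨ colProd*rowProd≡strict*diagonal² ℓ b r ⟩
  strictColProd ℓ b r * strictRowProd ℓ b r * (b r r * b r r)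
    ≡⟨ cong₂ (λ C R → C * R * (b r r * b r r))
         (strictColProd-withDiagonal ℓ e c r) (strictRowProd-withDiagonal ℓ e c r) ⟩
  strictColProd ℓ c r * strictRowProd ℓ c r * (b r r * b r r)
    ≡⟨ cong (λ x → strictColProd ℓ c r * strictRowProd ℓ c r * (x * x)) (withDiagonal-diagonal e c r) ⟩
  strictColProd ℓ c r * strictRowProd ℓ c r * (e r * e r) ∎
  where
  b = withDiagonal e c

lemma2p2 : (ℓ : ℕ) (ν : Fin ℓ → ℕ) →
    ((r : Fin ℓ) → 0 < ν r) →
    IsSquare (∏ ℓ ν) →
    Σ (Fin ℓ → Fin ℓ → ℕ) (λ b →
      ((r s : Fin ℓ) → toℕ r ≤ toℕ s → 0 < b r s) ×
      ((r : Fin ℓ) →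
        IsSq (ν r) (b r r * b r r) ×
        ν r ≡ colProd ℓ b r * rowProd ℓ b r))
lemma2p2 ℓ ν ν>0 ∏ν-square = b , (λ r s _ → withDiagonal-positive e>0 c>0 r s) , λ r → b-isSq r , ν≡col*row r
  where
  module F (r : Fin ℓ) = SquareFactorisation (squareFactorisation (ν r) (ν>0 r))
  e = F.root
  e>0 = F.root>0
  q = F.kernel
  ∏q-square : IsSquare (∏ ℓ q)
  ∏q-square = square-cancelˡ (∏ ℓ e) (∏ ℓ q) (∏-positive ℓ e e>0)
    (subst IsSquare (trans (∏-cong ℓ F.n≡kernel*root²) (∏-*-square ℓ q e)) ∏ν-square)
  strict = squareFree⇒strictTriangularFactorisation ℓ q F.kernel-squareFree ∏q-square
  c   = proj₁ strict
  c>0 = proj₁ (proj₂ strict)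
  b   = withDiagonal e c
  b-isSq : ∀ r → IsSq (ν r) (b r r * b r r)
  b-isSq r = subst (λ x → IsSq (ν r) (x * x)) (sym (withDiagonal-diagonal e c r)) (F.isSq r)
  ν≡col*row : ∀ r → ν r ≡ colProd ℓ b r * rowProd ℓ b r
  ν≡col*row r = begin
    ν r                                                     ≡⟨ F.n≡kernel*root² r ⟩
    q r * (e r * e r)                                       ≡⟨ cong (_* (e r * e r)) (proj₂ (proj₂ strict) r) ⟩
    strictColProd ℓ c r * strictRowProd ℓ c r * (e r * e r) ≡⟨ sym (colProd*rowProd-withDiagonal ℓ e c r) ⟩
    colProd ℓ b r * rowProd ℓ b r                           ∎
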